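{- Let $\mathbf u$ be a recurrent infinite word over a finite alphabet and let $w$ be a nonempty factor of $\mathbf u$ whose index in $\mathbf u$ is maximal among the indices of all conjugates of $w$, and suppose this index is strictly greater than $1$. Let $w^\ell w'$ be the maximal power of $w$ in $\mathbf u$, where $\ell\ge 1$ and $w'$ is a proper prefix of $w$. Let $b$ be the last letter of $w$ and let $a$ be the letter such that $w'a$ is a prefix of $w$. Then: (i) $b\notin\mathrm{Lext}(w^\ell w')$ and $a\notin\mathrm{Rext}(w^\ell w')$; (ii) for every $k=0,1,\dots,\ell-1$, the word $w^kw'$ is a bispecial factor of $\mathbf u$ with $b\in\mathrm{Lext}(w^kw')$ and $a\in\mathrm{Rext}(w^kw')$.
   Context: An infinite word $\mathbf u$ is recurrent if every factor occurs at least twice. $\mathcal L(\mathbf u)$ is the set of factors of $\mathbf u$. For $w\in\mathcal L(\mathbf u)$, $\mathrm{Lext}(w)=\{x: xw\in\mathcal L(\mathbf u)\}$, $\mathrm{Rext}(w)=\{x: wx\in\mathcal L(\mathbf u)\}$; $w$ is bispecial if $\#\mathrm{Lext}(w)\ge2$ and $\#\mathrm{Rext}(w)\ge2$. A word $v$ is a power of a nonempty word $w$ if $v$ is a prefix of $w^\omega=www\cdots$. The index of $w$ in $\mathbf u$ is $\mathrm{ind}(w)=\sup\{|v|/|w|: v\in\mathcal L(\mathbf u),\ v\text{ a power of }w\}$; a maximal power of $w$ is a factor $v$ that is a power of $w$ with $|v|/|w|=\mathrm{ind}(w)$. The cyclic shift of a word $w$ with last letter $x$ is $xwx^{ -1}$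 (move the last letter to the front); the conjugates of $w$ are its iterated cyclic shifts. -}

module Defs where

open import Data.Nat using (ℕ; zero; suc; _+_; _≤_; _<_)
open import Data.Fin using (Fin)
open import Data.List using (List; []; _∷_; _++_; _∷ʳ_; concat; replicate; length)
open import Data.Product using (Σ; ∃; ∃-syntax; _×_; _,_; proj₁; proj₂)
open import Data.Unit using (⊤)
open import Relation.Binary.PropositionalEquality using (_≡_; _≢_)

Word : ℕ → Set
Word d = ℕ → Fin d

OccursAt : ∀ {d} → Word d → List (Fin d) → ℕ → Set
OccursAt u [] i = ⊤
OccursAt u (x ∷ w) i = (u i ≡ x) × OccursAt u w (suc i)

Factor : ∀ {d} → Word d → List (Fin d) → Set
Factor u w = ∃[ i ] OccursAt u w i

Recurrent : ∀ {d} → Word d → Set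
Recurrent u = ∀ w → Factor u w → ∃[ i ] ∃[ j ] (i ≢ j × OccursAt u w i × OccursAt u w j)

Lext : ∀ {d} → Word d → List (Fin d) → Fin d → Set
Lext u w x = Factor u (x ∷ w)

Rext : ∀ {d} → Word d → List (Fin d) → Fin d → Set
Rext u w x = Factor u (w ∷ʳ x)

Bispecial : ∀ {d} → Word d → List (Fin d) → Set
Bispecial u w = Factor u w
  × (∃[ x ] ∃[ y ] (x ≢ y × Lext u w x × Lext u w y))
  × (∃[ x ] ∃[ y ] (x ≢ y × Rext u w x × Rext u w y))

_^ʷ_ : ∀ {A : Set} → List A → ℕ → List A
w ^ʷ n = concat (replicate n w)

-- v is a power of w: v is a prefix of w^ω, i.e. a prefix of w^n for some n
IsPowerOf : ∀ {A : Set} → List A → List A → Set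
IsPowerOf v w = ∃[ n ] ∃[ s ] (v ++ s ≡ w ^ʷ n)

lastInit : ∀ {A : Set} → A → List A → A × List A
lastInit x [] = x , []
lastInit x (y ∷ ys) = proj₁ (lastInit y ys) , x ∷ proj₂ (lastInit y ys)

cyclicShift : ∀ {A : Set} → List A → List A
cyclicShift [] = []
cyclicShift (x ∷ xs) = proj₁ (lastInit x xs) ∷ proj₂ (lastInit x xs)

shiftIter : ∀ {A : Set} → ℕ → List A → List A
shiftIter zero w = w
shiftIter (suc k) w = cyclicShift (shiftIter k w)

Conjugate : ∀ {A : Set} → List A → List A → Set
Conjugate c w = ∃[ k ] (c ≡ shiftIter k w)

-- ind(w) ≤ N / |w| : every factor of u that is a power of w has length ≤ N.
-- (Since ind(w) = sup{|v|/|w|}, this is exactly ind(w) ≤ N/|w|.)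
PowerLengthsBoundedBy : ∀ {d} → Word d → List (Fin d) → ℕ → Set
PowerLengthsBoundedBy u w N = ∀ v → Factor u v → IsPowerOf v w → length v ≤ N

-- v is a maximal power of w in u: a factor power of w of length |w|·ind(w)
-- (the supremum is attained at v)
MaximalPower : ∀ {d} → Word d → List (Fin d) → List (Fin d) → Set
MaximalPower u v w = Factor u v × IsPowerOf v w × PowerLengthsBoundedBy u w (length v)

-- Write v = w^ℓ w' and w = p b.  Both v a and b v are powers (of w, resp. of
-- its conjugate b p) of length |v| + 1, so neither occurs in u, since no conjugate
-- of w has a longer power than |v|.  For k < ℓ the word w^k w' occurs in v as a
-- prefix followed by a and as a suffix preceded by b.  The letter following some
-- occurrence of v, and (by recurrence) the letter preceding some non-initial
-- occurrence of v, therefore differ from a and b and give w^k w' a second right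
-- and a second left extension.
module Submission where

open import Defs
open import Data.Nat using (ℕ; zero; suc; _+_; _≤_; _<_)
open import Data.Nat.Properties using (+-suc; +-comm; m≤n⇒∃[o]m+o≡n; m+1+n≰m)
open import Data.Fin using (Fin)
open import Data.List using (List; []; _∷_; _++_; _∷ʳ_; length)
open import Data.List.Properties using (++-assoc; ++-identityʳ; length-++; ∷-injective; ∷ʳ-++)
open import Data.Product using (∃-syntax; _×_; _,_; proj₁; proj₂; map₂)
open import Data.Unit using (tt)
open import Relation.Binary.PropositionalEquality using (_≡_; _≢_; refl; sym; trans; cong; subst; module ≡-Reasoning)
open import Relation.Nullary using (¬_; contradiction)

module _ {A : Set} where

  ^ʷ-sucʳ : (w : List A) (n : ℕ) → w ^ʷ suc n ≡ w ^ʷ n ++ w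
  ^ʷ-sucʳ w zero    = ++-identityʳ w
  ^ʷ-sucʳ w (suc n) = trans (cong (w ++_) (^ʷ-sucʳ w n)) (sym (++-assoc w (w ^ʷ n) w))

  ^ʷ-+ : (w : List A) (m n : ℕ) → w ^ʷ (m + n) ≡ w ^ʷ m ++ w ^ʷ n
  ^ʷ-+ w zero    n = refl
  ^ʷ-+ w (suc m) n = trans (cong (w ++_) (^ʷ-+ w m n)) (sym (++-assoc w (w ^ʷ m) (w ^ʷ n)))

  ∷-^ʷ-∷ʳ : (b : A) (p : List A) (n : ℕ) → b ∷ (p ∷ʳ b) ^ʷ n ++ p ≡ (b ∷ p) ^ʷ suc n
  ∷-^ʷ-∷ʳ b p zero    = cong (b ∷_) (sym (++-identityʳ p))
  ∷-^ʷ-∷ʳ b p (suc n) = cong (b ∷_) (begin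
    ((p ∷ʳ b) ++ (p ∷ʳ b) ^ʷ n) ++ p  ≡⟨ ++-assoc (p ∷ʳ b) _ p ⟩
    (p ∷ʳ b) ++ (p ∷ʳ b) ^ʷ n ++ p    ≡⟨ ∷ʳ-++ p b _ ⟩
    p ++ b ∷ (p ∷ʳ b) ^ʷ n ++ p       ≡⟨ cong (p ++_) (∷-^ʷ-∷ʳ b p n) ⟩
    p ++ (b ∷ p) ^ʷ suc n             ∎)
    where open ≡-Reasoning

  lastInit-∷ʳ : (x b : A) (ys : List A) → lastInit x (ys ∷ʳ b) ≡ (b , x ∷ ys)
  lastInit-∷ʳ x b []       = refl
  lastInit-∷ʳ x b (y ∷ ys) rewrite lastInit-∷ʳ y b ys = refl

  cyclicShift-∷ʳ : (p : List A) (b : A) → cyclicShift (p ∷ʳ b) ≡ b ∷ p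
  cyclicShift-∷ʳ []      b = refl
  cyclicShift-∷ʳ (x ∷ p) b rewrite lastInit-∷ʳ x b p = refl

  conjugate-∷ʳ : (p : List A) (b : A) → Conjugate (b ∷ p) (p ∷ʳ b)
  conjugate-∷ʳ p b = 1 , sym (cyclicShift-∷ʳ p b)

  ++-∷≡∷ʳ⇒prefix : (xs : List A) {y : A} {ys zs : List A} {z : A} → xs ++ y ∷ ys ≡ zs ∷ʳ z → ∃[ t ] xs ++ t ≡ zs
  ++-∷≡∷ʳ⇒prefix []           {zs = zs}     _  = zs , refl
  ++-∷≡∷ʳ⇒prefix (_ ∷ [])     {zs = []}     ()
  ++-∷≡∷ʳ⇒prefix (_ ∷ _ ∷ _)  {zs = []}     ()
  ++-∷≡∷ʳ⇒prefix (x ∷ xs)     {zs = _ ∷ _} eq with refl , eq′ ← ∷-injective eq =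
    map₂ (cong (x ∷_)) (++-∷≡∷ʳ⇒prefix xs eq′)

module _ {A : Set} {w w' : List A} where

  isPowerOf-∷ʳ : ∀ {a s} → w ≡ w' ++ a ∷ s → (n : ℕ) → IsPowerOf ((w ^ʷ n ++ w') ∷ʳ a) w
  isPowerOf-∷ʳ {a} {s} w≡w'as n = suc n , s , (begin
    (w ^ʷ n ++ w') ∷ʳ a ++ s  ≡⟨ ∷ʳ-++ (w ^ʷ n ++ w') a s ⟩
    (w ^ʷ n ++ w') ++ a ∷ s   ≡⟨ ++-assoc (w ^ʷ n) w' (a ∷ s) ⟩
    w ^ʷ n ++ w' ++ a ∷ s     ≡⟨ cong (w ^ʷ n ++_) w≡w'as ⟨
    w ^ʷ n ++ w               ≡⟨ ^ʷ-sucʳ w n ⟨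
    w ^ʷ suc n                ∎)
    where open ≡-Reasoning

  isPowerOf-∷ : ∀ {p b} → w ≡ p ∷ʳ b → ∀ {t} → w' ++ t ≡ p → (n : ℕ) → IsPowerOf (b ∷ w ^ʷ n ++ w') (b ∷ p)
  isPowerOf-∷ {p} {b} w≡pb {t} w't≡p n = suc n , t , (begin
    b ∷ (w ^ʷ n ++ w') ++ t     ≡⟨ cong (b ∷_) (++-assoc (w ^ʷ n) w' t) ⟩
    b ∷ w ^ʷ n ++ w' ++ t       ≡⟨ cong (λ x → b ∷ w ^ʷ n ++ x) w't≡p ⟩
    b ∷ w ^ʷ n ++ p             ≡⟨ cong (λ x → b ∷ x ^ʷ n ++ p) w≡pb ⟩
    b ∷ (p ∷ʳ b) ^ʷ n ++ p      ≡⟨ ∷-^ʷ-∷ʳ b p n ⟩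
    (b ∷ p) ^ʷ suc n            ∎)
    where open ≡-Reasoning

  ^ʷ-++-prefix : ∀ {a s} → w ≡ w' ++ a ∷ s → (k m : ℕ) →
                 w ^ʷ (k + suc m) ++ w' ≡ (w ^ʷ k ++ w') ++ a ∷ s ++ w ^ʷ m ++ w'
  ^ʷ-++-prefix {a} {s} w≡w'as k m = begin
    w ^ʷ (k + suc m) ++ w'           ≡⟨ cong (_++ w') (^ʷ-+ w k (suc m)) ⟩
    (w ^ʷ k ++ w ++ w ^ʷ m) ++ w'    ≡⟨ ++-assoc (w ^ʷ k) _ w' ⟩
    w ^ʷ k ++ (w ++ w ^ʷ m) ++ w'    ≡⟨ cong (λ x → w ^ʷ k ++ (x ++ w ^ʷ m) ++ w') w≡w'as ⟩
    w ^ʷ k ++ ((w' ++ a ∷ s) ++ w ^ʷ m) ++ w'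
      ≡⟨ cong (w ^ʷ k ++_) (trans (++-assoc (w' ++ a ∷ s) _ w') (++-assoc w' _ _)) ⟩
    w ^ʷ k ++ w' ++ a ∷ s ++ w ^ʷ m ++ w'
      ≡⟨ ++-assoc (w ^ʷ k) w' _ ⟨
    (w ^ʷ k ++ w') ++ a ∷ s ++ w ^ʷ m ++ w' ∎
    where open ≡-Reasoning

  ^ʷ-++-suffix : ∀ {p b} → w ≡ p ∷ʳ b → (m k : ℕ) →
                 w ^ʷ (m + suc k) ++ w' ≡ (w ^ʷ m ++ p) ++ b ∷ w ^ʷ k ++ w'
  ^ʷ-++-suffix {p} {b} w≡pb m k = begin
    w ^ʷ (m + suc k) ++ w'           ≡⟨ cong (_++ w') (^ʷ-+ w m (suc k)) ⟩
    (w ^ʷ m ++ w ++ w ^ʷ k) ++ w'    ≡⟨ ++-assoc (w ^ʷ m) _ w' ⟩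
    w ^ʷ m ++ (w ++ w ^ʷ k) ++ w'    ≡⟨ cong (λ x → w ^ʷ m ++ (x ++ w ^ʷ k) ++ w') w≡pb ⟩
    w ^ʷ m ++ ((p ∷ʳ b) ++ w ^ʷ k) ++ w'
      ≡⟨ cong (w ^ʷ m ++_) (trans (++-assoc (p ∷ʳ b) _ w') (∷ʳ-++ p b _)) ⟩
    w ^ʷ m ++ p ++ b ∷ w ^ʷ k ++ w'  ≡⟨ ++-assoc (w ^ʷ m) p _ ⟨
    (w ^ʷ m ++ p) ++ b ∷ w ^ʷ k ++ w' ∎
    where open ≡-Reasoning

  ^ʷ-++-border : ∀ {a s p b} → w ≡ w' ++ a ∷ s → w ≡ p ∷ʳ b → ∀ {k ℓ} → k < ℓ →
                 (∃[ q ] w ^ʷ ℓ ++ w' ≡ q ++ b ∷ w ^ʷ k ++ w')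
               × (∃[ r ] w ^ʷ ℓ ++ w' ≡ (w ^ʷ k ++ w') ++ a ∷ r)
  ^ʷ-++-border w≡w'as w≡pb {k} k<ℓ with m , refl ← m≤n⇒∃[o]m+o≡n k<ℓ =
      (_ , trans (cong (λ n → w ^ʷ n ++ w') (+-comm (suc k) m)) (^ʷ-++-suffix w≡pb m k))
    , (_ , trans (cong (λ n → w ^ʷ n ++ w') (sym (+-suc k m))) (^ʷ-++-prefix w≡w'as k m))

module _ {d : ℕ} (u : Word d) where

  occursAt-++⁻ : ∀ xs {ys} i → OccursAt u (xs ++ ys) i → OccursAt u xs i × OccursAt u ys (i + length xs)
  occursAt-++⁻ []       i o = tt , subst (OccursAt u _) (sym (+-comm i 0)) o
  occursAt-++⁻ (x ∷ xs) i (ux , o) with o₁ , o₂ ← occursAt-++⁻ xs (suc i) o =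
    (ux , o₁) , subst (OccursAt u _) (sym (+-suc i (length xs))) o₂

  occursAt-++⁺ : ∀ xs {ys} i → OccursAt u xs i → OccursAt u ys (i + length xs) → OccursAt u (xs ++ ys) i
  occursAt-++⁺ []       i _          o₂ = subst (OccursAt u _) (+-comm i 0) o₂
  occursAt-++⁺ (x ∷ xs) i (ux , o₁) o₂ = ux , occursAt-++⁺ xs (suc i) o₁ (subst (OccursAt u _) (+-suc i (length xs)) o₂)

  factor-++⁻ˡ : ∀ xs {ys} → Factor u (xs ++ ys) → Factor u xs
  factor-++⁻ˡ xs (i , o) = i , proj₁ (occursAt-++⁻ xs i o)

  factor-++⁻ʳ : ∀ xs {ys} → Factor u (xs ++ ys) → Factor u ys
  factor-++⁻ʳ xs (i , o) = _ , proj₂ (occursAt-++⁻ xs i o)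

  factor-extendʳ : ∀ {v} → Factor u v → ∃[ y ] Factor u (v ∷ʳ y)
  factor-extendʳ {v} (i , o) = u (i + length v) , i , occursAt-++⁺ v i o (refl , tt)

  recurrent⇒factor-extendˡ : Recurrent u → ∀ {v} → Factor u v → ∃[ x ] Factor u (x ∷ v)
  recurrent⇒factor-extendˡ rec {v} f with rec v f
  ... | zero  , zero  , i≢j , _     = contradiction refl i≢j
  ... | suc i , _     , _   , o , _ = u i , i , refl , o
  ... | zero  , suc j , _   , _ , o = u j , j , refl , o

  bounded⇒¬factor : ∀ {c v N} → PowerLengthsBoundedBy u c N → IsPowerOf v c → length v ≡ N + 1 → ¬ Factor u v
  bounded⇒¬factor {N = N} bound pow |v|≡N+1 f = m+1+n≰m N (subst (_≤ N) |v|≡N+1 (bound _ f pow))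

  bispecial-border : Recurrent u → ∀ {v z q r} {a b} → Factor u v → ¬ Lext u v b → ¬ Rext u v a →
                     v ≡ q ++ b ∷ z → v ≡ z ++ a ∷ r →
                     Bispecial u z × Lext u z b × Rext u z a
  bispecial-border rec {z = z} {q} {r} {a} {b} fv ¬bv ¬va v≡qbz v≡zar
    with x , xv ← recurrent⇒factor-extendˡ rec fv | y , vy ← factor-extendʳ fv =
    (fz , (x , b , x≢b , xz , bz) , (a , y , a≢y , za , zy)) , bz , za
    where
    bz : Lext u z b
    bz = factor-++⁻ʳ q (subst (Factor u) v≡qbz fv)
    za : Rext u z a
    za = factor-++⁻ˡ (z ∷ʳ a) (subst (Factor u) (trans v≡zar (sym (∷ʳ-++ z a r))) fv)
    fz : Factor u z
    fz = factor-++⁻ˡ z za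
    xz : Lext u z x
    xz = factor-++⁻ˡ (x ∷ z) (subst (Factor u) (cong (x ∷_) v≡zar) xv)
    zy : Rext u z y
    zy = factor-++⁻ʳ (b ∷ []) (factor-++⁻ʳ q
           (subst (Factor u) (trans (cong (_∷ʳ y) v≡qbz) (++-assoc q (b ∷ z) (y ∷ []))) vy))
    x≢b : x ≢ b
    x≢b refl = ¬bv xv
    a≢y : a ≢ y
    a≢y refl = ¬va vy

lemma3p1 : ∀ {d : ℕ} (u : Word d) (w : List (Fin d)) (ℓ : ℕ) (w' : List (Fin d)) (a b : Fin d)
    → Recurrent u
    → w ≢ []
    → Factor u w
    → 1 ≤ ℓ
    → (∃[ s ] (w ≡ w' ++ (a ∷ s)))
    → (∃[ p ] (w ≡ p ∷ʳ b))
    → MaximalPower u ((w ^ʷ ℓ) ++ w') w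
    → (∀ c → Conjugate c w → PowerLengthsBoundedBy u c (length ((w ^ʷ ℓ) ++ w')))
    → length w < length ((w ^ʷ ℓ) ++ w')
    → ((¬ Lext u ((w ^ʷ ℓ) ++ w') b) × (¬ Rext u ((w ^ʷ ℓ) ++ w') a))
      × (∀ k → k < ℓ → Bispecial u ((w ^ʷ k) ++ w') × Lext u ((w ^ʷ k) ++ w') b × Rext u ((w ^ʷ k) ++ w') a)
lemma3p1 u w ℓ w' a b rec _ _ _ (s , w≡w'as) (p , w≡pb) (fv , _ , bound) conjugate-bound _ =
  (¬bv , ¬va) , λ k k<ℓ →
    let (_ , v≡qbz) , (_ , v≡zar) = ^ʷ-++-border w≡w'as w≡pb k<ℓ
    in  bispecial-border u rec fv ¬bv ¬va v≡qbz v≡zar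
  where
  v = w ^ʷ ℓ ++ w'

  ¬va : ¬ Rext u v a
  ¬va = bounded⇒¬factor u bound (isPowerOf-∷ʳ w≡w'as ℓ) (length-++ v)

  ¬bv : ¬ Lext u v b
  ¬bv with t , w't≡p ← ++-∷≡∷ʳ⇒prefix w' (trans (sym w≡w'as) w≡pb) =
    bounded⇒¬factor u (conjugate-bound (b ∷ p) (subst (Conjugate (b ∷ p)) (sym w≡pb) (conjugate-∷ʳ p b)))
                      (isPowerOf-∷ w≡pb w't≡p ℓ) (+-comm 1 (length v))
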